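{- For every nonnegative integer $r$, \[ \sum_{n=1}^{\infty}\frac{h_{n}^{(r)}}{(n+1)(n+2)\cdots(n+r+1)}=\frac{1}{r!}. \]
   Context: Hyperharmonic numbers: $h_n^{(0)}=1/n$ for $n\in\mathbb{N}=\{1,2,3,\dots\}$, and for $r\in\mathbb{N}$, $h_n^{(r)}=\sum_{k=1}^{n}h_k^{(r-1)}$ (so $h_n^{(1)}=H_n=\sum_{k=1}^n1/k$). -}

module Defs where

open import Data.Nat as ℕ using (ℕ; zero; suc; _!; _≥_)
open import Data.Nat.Properties using (_!≢0)
open import Data.Integer using (+_)
open import Data.Rational using (ℚ; _/_; _+_; _*_; _-_; ∣_∣; _<_; 0ℚ)
open import Data.Product using (∃)

sumTo : ℕ → (ℕ → ℚ) → ℚ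
sumTo zero    f = 0ℚ
sumTo (suc m) f = sumTo m f + f m

-- hyp r m = h_{m+1}^{(r)}  (shifted so the index m ranges over all of ℕ)
hyp : ℕ → ℕ → ℚ
hyp zero    m = + 1 / suc m
hyp (suc r) m = sumTo (suc m) (hyp r)

-- recip m k = 1 / ((m+1)(m+2)...(m+k))   (empty product = 1 when k = 0)
recipRising : ℕ → ℕ → ℚ
recipRising m zero    = + 1 / 1
recipRising m (suc k) = recipRising m k * (+ 1 / suc (m ℕ.+ k))

-- term of the series for index n = m+1:
--   h_n^{(r)} / ((n+1)(n+2)...(n+r+1)),  with n+j = suc (m + j) for j=1..r+1
term : ℕ → ℕ → ℚ
term r m = hyp r m * recipRising (suc m) (suc r)

-- partial sum  Σ_{n=1}^{N} term
partialSum : ℕ → ℕ → ℚ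
partialSum r N = sumTo N (term r)

invFact : ℕ → ℚ
invFact r = _/_ (+ 1) (r !) {{r !≢0}}

ConvergesTo : (ℕ → ℚ) → ℚ → Set
ConvergesTo s L = ∀ (ε : ℚ) → 0ℚ < ε → ∃ λ N → ∀ M → M ≥ N → ∣ s M - L ∣ < ε

module Submission where

-- Write R a k = 1/((a+1)…(a+k)), so that the n-th term of the series is
-- h_n^(r) · R n (r+1), and let  remainder r N = 1/r! − (N-th partial sum).
--  * Reciprocal rising factorials telescope:  k · R a (k+1) + R (a+1) k = R a k  (R-telescope).
--    For r = 0 the series itself telescopes, so remainder 0 N = 1/(N+1).
--  * Summation by parts with the same identity links consecutive orders:
--    (r+1) · remainder (r+1) N = remainder r N + boundary r N, where the boundary term
--    boundary r N = h_N^(r+1) / ((N+2)…(N+r+2)) is non-negative.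
--  * Since h_N^(r+2) = Σ_{m≤N} h_m^(r+1) ≤ N · h_N^(r+1), the boundary terms decrease in r; by induction
--    0 ≤ remainder r N ≤ 1/(N+1) + r · boundary 0 N, and boundary 0 N = H_N/(N+2).
--  * Splitting the harmonic sum at an arbitrary m gives H_N ≤ m + N/(m+1), hence
--    remainder r N ≤ (1 + r m)/(N+1) + r/(m+1).  Choosing first m and then N large
--    (the Archimedean property of ℚ) makes this smaller than any ε > 0.
-- The file develops, in this order, the natural numbers inside ℚ, the rising-factorial
-- identities, the two exact identities for the remainder, the estimates, and the theorem.

open import Defs
open import Data.Nat as ℕ using (ℕ; zero; suc; _!)
import Data.Nat.Properties as ℕP
open import Data.Integer as ℤ using (+[1+_]; -[1+_])
import Data.Integer.Properties as ℤP
open import Data.Rational as ℚ using (ℚ; mkℚ; nonNegative; positive; _/_; _+_; _*_; _-_; -_; ∣_∣; _<_; _≤_; 0ℚ; 1ℚ; *≤*; *<*)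
open import Data.Rational.Properties
import Data.Rational.Unnormalised as U
import Data.Rational.Unnormalised.Properties as UP
import Data.Nat.Coprimality as C
open import Data.Rational.Solver
open +-*-Solver using (solve; _:+_; _:*_; _:-_; :-_; _:=_; con)
open import Relation.Binary.PropositionalEquality
open import Relation.Nullary using (yes; no)
open import Data.Product using (∃; _,_; proj₁; proj₂)

-- The natural number k as a rational.  Its numerator is syntactically non-negative, so the
-- library's instance search proves 0 ≤ ι k and 0 < ι (suc k) by itself.
ι : ℕ → ℚ
ι k = mkℚ (ℤ.+ k) 0 (C.sym (C.1-coprimeTo k))

ι-+ : ∀ a b → ι (a ℕ.+ b) ≡ ι a + ι b
ι-+ a b = toℚᵘ-injective (UP.≃-sym (UP.≃-trans (toℚᵘ-homo-+ (ι a) (ι b)) (U.*≡* numerators)))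
  where
  open ≡-Reasoning
  numerators : (ℤ.+ a ℤ.* ℤ.+ 1 ℤ.+ ℤ.+ b ℤ.* ℤ.+ 1) ℤ.* ℤ.+ 1 ≡ ℤ.+ (a ℕ.+ b) ℤ.* ℤ.+ 1
  numerators = cong (ℤ._* ℤ.+ 1) (begin
    ℤ.+ a ℤ.* ℤ.+ 1 ℤ.+ ℤ.+ b ℤ.* ℤ.+ 1  ≡⟨ cong₂ ℤ._+_ (ℤP.*-identityʳ (ℤ.+ a)) (ℤP.*-identityʳ (ℤ.+ b)) ⟩
    ℤ.+ a ℤ.+ ℤ.+ b                      ≡⟨ sym (ℤP.pos-+ a b) ⟩
    ℤ.+ (a ℕ.+ b)                        ∎)

ι-suc : ∀ k → ι (suc k) ≡ 1ℚ + ι k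
ι-suc = ι-+ 1

ι-* : ∀ a b → ι (a ℕ.* b) ≡ ι a * ι b
ι-* a b = toℚᵘ-injective (UP.≃-sym (UP.≃-trans (toℚᵘ-homo-* (ι a) (ι b)) (U.*≡* numerators)))
  where
  numerators : (ℤ.+ a ℤ.* ℤ.+ b) ℤ.* ℤ.+ 1 ≡ ℤ.+ (a ℕ.* b) ℤ.* ℤ.+ 1
  numerators = cong (ℤ._* ℤ.+ 1) (sym (ℤP.pos-* a b))

-- Monotonicity of multiplication with the sign condition passed as a proof rather than an
-- instance, as it is needed for quantities whose non-negativity is itself a lemma.
nonNeg-* : ∀ {x y} → 0ℚ ≤ x → 0ℚ ≤ y → 0ℚ ≤ x * y
nonNeg-* {x} {y} 0≤x 0≤y =
  nonNegative⁻¹ (x * y) {{nonNeg*nonNeg⇒nonNeg x {{nonNegative 0≤x}} y {{nonNegative 0≤y}}}}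

*-monoˡ-≤-0≤ : ∀ {c x y} → 0ℚ ≤ c → x ≤ y → c * x ≤ c * y
*-monoˡ-≤-0≤ {c} 0≤c = *-monoˡ-≤-nonNeg c {{nonNegative 0≤c}}

*-monoʳ-≤-0≤ : ∀ {c x y} → 0ℚ ≤ c → x ≤ y → x * c ≤ y * c
*-monoʳ-≤-0≤ {c} 0≤c = *-monoʳ-≤-nonNeg c {{nonNegative 0≤c}}

≤-+-0≤ : ∀ {x y} → 0ℚ ≤ y → x ≤ x + y
≤-+-0≤ {x} {y} 0≤y = subst (_≤ x + y) (+-identityʳ x) (+-monoʳ-≤ x 0≤y)

ι-mono : ∀ {a b} → a ℕ.≤ b → ι a ≤ ι b
ι-mono {a} {b} a≤b =
  subst (ι a ≤_) (trans (sym (ι-+ a (b ℕ.∸ a))) (cong ι (ℕP.m+[n∸m]≡n a≤b)))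
        (≤-+-0≤ (nonNegative⁻¹ (ι (b ℕ.∸ a))))

ι<ι-suc : ∀ n → ι n < ι (suc n)
ι<ι-suc n = subst₂ _<_ (+-identityˡ (ι n)) (sym (ι-suc n)) (+-monoˡ-< (ι n) (positive⁻¹ 1ℚ))

inv : ℕ → ℚ
inv n = ℤ.+ 1 / suc n

-- The normal form of inv n, from which its sign and its inverse can be read off.
inv-nf : ∀ n → inv n ≡ mkℚ (ℤ.+ 1) n (C.1-coprimeTo (suc n))
inv-nf n = normalize-coprime (C.1-coprimeTo (suc n))

1/n*n≡1 : ∀ n .{{_ : ℕ.NonZero n}} → (ℤ.+ 1 / n) * ι n ≡ 1ℚ
1/n*n≡1 (suc n) rewrite inv-nf n = *-inverseʳ (mkℚ (ℤ.+ 1) n (C.1-coprimeTo (suc n)))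

inv-ι : ∀ n → inv n * ι (suc n) ≡ 1ℚ
inv-ι n = 1/n*n≡1 (suc n)

inv>0 : ∀ n → 0ℚ < inv n
inv>0 n rewrite inv-nf n = positive⁻¹ (mkℚ (ℤ.+ 1) n (C.1-coprimeTo (suc n)))

inv≥0 : ∀ n → 0ℚ ≤ inv n
inv≥0 n = <⇒≤ (inv>0 n)

inv-anti : ∀ {m n} → m ℕ.≤ n → inv n ≤ inv m
inv-anti {m} {n} m≤n = begin
  inv n                        ≡⟨ sym (*-identityʳ (inv n)) ⟩
  inv n * 1ℚ                   ≡⟨ cong (inv n *_) (sym (inv-ι m)) ⟩
  inv n * (inv m * ι (suc m))  ≤⟨ *-monoˡ-≤-0≤ (inv≥0 n) (*-monoˡ-≤-0≤ (inv≥0 m) (ι-mono (ℕ.s≤s m≤n))) ⟩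
  inv n * (inv m * ι (suc n))  ≡⟨ solve 3 (λ a b c → a :* (b :* c) := b :* (a :* c)) refl (inv n) (inv m) (ι (suc n)) ⟩
  inv m * (inv n * ι (suc n))  ≡⟨ cong (inv m *_) (inv-ι n) ⟩
  inv m * 1ℚ                   ≡⟨ *-identityʳ (inv m) ⟩
  inv m                        ∎
  where open ≤-Reasoning

ι*inv≤1 : ∀ {k n} → k ℕ.≤ suc n → ι k * inv n ≤ 1ℚ
ι*inv≤1 {k} {n} k≤n+1 = begin
  ι k * inv n        ≤⟨ *-monoʳ-≤-0≤ (inv≥0 n) (ι-mono k≤n+1) ⟩
  ι (suc n) * inv n  ≡⟨ *-comm (ι (suc n)) (inv n) ⟩
  inv n * ι (suc n)  ≡⟨ inv-ι n ⟩
  1ℚ                 ∎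
  where open ≤-Reasoning

R : ℕ → ℕ → ℚ
R = recipRising

R≥0 : ∀ a k → 0ℚ ≤ R a k
R≥0 a zero    = nonNegative⁻¹ 1ℚ
R≥0 a (suc k) = nonNeg-* (R≥0 a k) (inv≥0 (a ℕ.+ k))

R-peel : ∀ a k → R a (suc k) ≡ inv a * R (suc a) k
R-peel a zero = begin
  1ℚ * inv (a ℕ.+ 0)  ≡⟨ *-identityˡ (inv (a ℕ.+ 0)) ⟩
  inv (a ℕ.+ 0)       ≡⟨ cong inv (ℕP.+-identityʳ a) ⟩
  inv a               ≡⟨ sym (*-identityʳ (inv a)) ⟩
  inv a * 1ℚ          ∎
  where open ≡-Reasoning
R-peel a (suc k) = begin
  R a (suc k) * inv (a ℕ.+ suc k)          ≡⟨ cong₂ _*_ (R-peel a k) (cong inv (ℕP.+-suc a k)) ⟩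
  inv a * R (suc a) k * inv (suc a ℕ.+ k)  ≡⟨ *-assoc (inv a) (R (suc a) k) (inv (suc a ℕ.+ k)) ⟩
  inv a * R (suc a) (suc k)                ∎
  where open ≡-Reasoning

R-one : ∀ a → R a 1 ≡ inv a
R-one a = trans (R-peel a 0) (*-identityʳ (inv a))

R-cancel : ∀ a k → R a (suc k) * ι (suc (a ℕ.+ k)) ≡ R a k
R-cancel a k = begin
  R a k * inv (a ℕ.+ k) * ι (suc (a ℕ.+ k))    ≡⟨ *-assoc (R a k) (inv (a ℕ.+ k)) (ι (suc (a ℕ.+ k))) ⟩
  R a k * (inv (a ℕ.+ k) * ι (suc (a ℕ.+ k)))  ≡⟨ cong (R a k *_) (inv-ι (a ℕ.+ k)) ⟩
  R a k * 1ℚ                                   ≡⟨ *-identityʳ (R a k) ⟩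
  R a k                                        ∎
  where open ≡-Reasoning

-- The basic telescoping identity of reciprocal rising factorials,
--   1/((a+1)…(a+k)) − 1/((a+2)…(a+k+1)) = k/((a+1)…(a+k+1)),
-- obtained by writing both terms over the common denominator (a+1)…(a+k+1).
R-telescope : ∀ a k → ι k * R a (suc k) + R (suc a) k ≡ R a k
R-telescope a k = begin
  ι k * R a (suc k) + R (suc a) k              ≡⟨ cong (ι k * R a (suc k) +_) first-factor ⟩
  ι k * R a (suc k) + ι (suc a) * R a (suc k)  ≡⟨ sym (*-distribʳ-+ (R a (suc k)) (ι k) (ι (suc a))) ⟩
  (ι k + ι (suc a)) * R a (suc k)              ≡⟨ cong (_* R a (suc k)) (sym (ι-+ k (suc a))) ⟩
  ι (k ℕ.+ suc a) * R a (suc k)                ≡⟨ cong (λ n → ι n * R a (suc k)) k+a+1≡a+k+1 ⟩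
  ι (suc (a ℕ.+ k)) * R a (suc k)              ≡⟨ *-comm (ι (suc (a ℕ.+ k))) (R a (suc k)) ⟩
  R a (suc k) * ι (suc (a ℕ.+ k))              ≡⟨ R-cancel a k ⟩
  R a k                                        ∎
  where
  open ≡-Reasoning
  k+a+1≡a+k+1 : k ℕ.+ suc a ≡ suc (a ℕ.+ k)
  k+a+1≡a+k+1 = trans (ℕP.+-suc k a) (cong suc (ℕP.+-comm k a))
  first-factor : R (suc a) k ≡ ι (suc a) * R a (suc k)
  first-factor = begin
    R (suc a) k                          ≡⟨ sym (*-identityˡ (R (suc a) k)) ⟩
    1ℚ * R (suc a) k                     ≡⟨ cong (_* R (suc a) k) (sym (inv-ι a)) ⟩
    inv a * ι (suc a) * R (suc a) k      ≡⟨ solve 3 (λ x y z → x :* y :* z := y :* (x :* z)) refl (inv a) (ι (suc a)) (R (suc a) k) ⟩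
    ι (suc a) * (inv a * R (suc a) k)    ≡⟨ cong (ι (suc a) *_) (sym (R-peel a k)) ⟩
    ι (suc a) * R a (suc k)              ∎

telescope : ∀ (f g : ℕ → ℚ) → (∀ m → f m + g (suc m) ≡ g m) → ∀ N → sumTo N f + g N ≡ g 0
telescope f g f≡Δg zero    = +-identityˡ (g 0)
telescope f g f≡Δg (suc N) = begin
  sumTo N f + f N + g (suc N)    ≡⟨ +-assoc (sumTo N f) (f N) (g (suc N)) ⟩
  sumTo N f + (f N + g (suc N))  ≡⟨ cong (sumTo N f +_) (f≡Δg N) ⟩
  sumTo N f + g N                ≡⟨ telescope f g f≡Δg N ⟩
  g 0                            ∎
  where open ≡-Reasoning

-- Order r = 0: term 0 m = 1/((m+1)(m+2)) = R m 1 − R (m+1) 1, so the series telescopes.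
partialSum-zero : ∀ N → partialSum 0 N + inv N ≡ 1ℚ
partialSum-zero N = subst (λ x → partialSum 0 N + x ≡ 1ℚ) (R-one N)
  (telescope (term 0) (λ m → R m 1) term≡ΔR N)
  where
  term≡ΔR : ∀ m → term 0 m + R (suc m) 1 ≡ R m 1
  term≡ΔR m = trans (cong (_+ R (suc m) 1) (sym (trans (*-identityˡ (R m 2)) (R-peel m 1))))
                    (R-telescope m 1)

-- The boundary term of the summation by parts:  h_N^(r+1) / ((N+2)(N+3)…(N+r+2)).
boundary : ℕ → ℕ → ℚ
boundary r N = sumTo N (hyp r) * R (suc N) (suc r)

-- Summation by parts, passing from order r+1 to order r:
--   (r+1) · partialSum (r+1) N + boundary r N = partialSum r N.
-- The step N → N+1 is exactly R-telescope applied to the new denominators.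
summation-by-parts : ∀ r N → ι (suc r) * partialSum (suc r) N + boundary r N ≡ partialSum r N
summation-by-parts r zero    = cong₂ _+_ (*-zeroʳ (ι (suc r))) (*-zeroˡ (R 1 (suc r)))
summation-by-parts r (suc N) = begin
  i * (P + (X + y) * Rˢ) + (X + y) * Rᵃ  ≡⟨ solve 6 (λ i P X y Rˢ Rᵃ → i :* (P :+ (X :+ y) :* Rˢ) :+ (X :+ y) :* Rᵃ := i :* P :+ (X :+ y) :* (i :* Rˢ :+ Rᵃ)) refl i P X y Rˢ Rᵃ ⟩
  i * P + (X + y) * (i * Rˢ + Rᵃ)        ≡⟨ cong (λ t → i * P + (X + y) * t) (R-telescope (suc N) (suc r)) ⟩
  i * P + (X + y) * R₀                   ≡⟨ solve 5 (λ i P X y R₀ → i :* P :+ (X :+ y) :* R₀ := (i :* P :+ X :* R₀) :+ y :* R₀) refl i P X y R₀ ⟩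
  (i * P + X * R₀) + y * R₀              ≡⟨ cong (_+ y * R₀) (summation-by-parts r N) ⟩
  partialSum r N + y * R₀                ∎
  where
  open ≡-Reasoning
  i P X y R₀ Rˢ Rᵃ : ℚ
  i = ι (suc r)
  P = partialSum (suc r) N
  X = sumTo N (hyp r)
  y = hyp r N
  R₀ = R (suc N) (suc r)
  Rˢ = R (suc N) (suc (suc r))
  Rᵃ = R (suc (suc N)) (suc r)

invFact-suc : ∀ r → ι (suc r) * invFact (suc r) ≡ invFact r
invFact-suc r = begin
  i * f'              ≡⟨ sym (*-identityʳ (i * f')) ⟩
  i * f' * 1ℚ         ≡⟨ cong (i * f' *_) (sym (trans (*-comm q f) (1/n*n≡1 (r !) {{r ℕP.!≢0}}))) ⟩
  i * f' * (q * f)    ≡⟨ solve 4 (λ i f' q f → i :* f' :* (q :* f) := f' :* (i :* q) :* f) refl i f' q f ⟩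
  f' * (i * q) * f    ≡⟨ cong (λ t → f' * t * f) (sym (ι-* (suc r) (r !))) ⟩
  f' * ι (suc r !) * f ≡⟨ cong (_* f) (1/n*n≡1 (suc r !) {{suc r ℕP.!≢0}}) ⟩
  1ℚ * f              ≡⟨ *-identityˡ f ⟩
  f                   ∎
  where
  open ≡-Reasoning
  i f' f q : ℚ
  i = ι (suc r)
  f' = invFact (suc r)
  f = invFact r
  q = ι (r !)

remainder : ℕ → ℕ → ℚ
remainder r N = invFact r - partialSum r N

remainder-zero : ∀ N → remainder 0 N ≡ inv N
remainder-zero N = begin
  1ℚ - S           ≡⟨ cong (_- S) (sym (partialSum-zero N)) ⟩
  (S + inv N) - S  ≡⟨ solve 2 (λ S x → (S :+ x) :- S := x) refl S (inv N) ⟩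
  inv N            ∎
  where
  open ≡-Reasoning
  S : ℚ
  S = partialSum 0 N

remainder-suc : ∀ r N → ι (suc r) * remainder (suc r) N ≡ remainder r N + boundary r N
remainder-suc r N = begin
  i * (f' - P')              ≡⟨ solve 4 (λ i f' P' B → i :* (f' :- P') := i :* f' :- (i :* P' :+ B) :+ B) refl i f' P' B ⟩
  i * f' - (i * P' + B) + B  ≡⟨ cong₂ (λ a b → a - b + B) (invFact-suc r) (summation-by-parts r N) ⟩
  invFact r - partialSum r N + B ∎
  where
  open ≡-Reasoning
  i f' P' B : ℚ
  i = ι (suc r)
  f' = invFact (suc r)
  P' = partialSum (suc r) N
  B = boundary r N

sumTo≥0 : ∀ f → (∀ m → 0ℚ ≤ f m) → ∀ N → 0ℚ ≤ sumTo N f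
sumTo≥0 f f≥0 zero    = ≤-refl
sumTo≥0 f f≥0 (suc N) = +-mono-≤ (sumTo≥0 f f≥0 N) (f≥0 N)

hyp≥0 : ∀ r m → 0ℚ ≤ hyp r m
hyp≥0 zero    m = inv≥0 m
hyp≥0 (suc r) m = sumTo≥0 (hyp r) (hyp≥0 r) (suc m)

boundary≥0 : ∀ r N → 0ℚ ≤ boundary r N
boundary≥0 r N = nonNeg-* (sumTo≥0 (hyp r) (hyp≥0 r) N) (R≥0 (suc N) (suc r))

-- For non-negative f every inner sum Σ_{j≤m} f j with m < N is at most Σ_{j<N} f j, so
--   Σ_{m<N} Σ_{j≤m} f j ≤ N · Σ_{j<N} f j.
-- Applied to f = hyp r this compares the orders r+1 and r.
nested-sum≤ : ∀ f → (∀ m → 0ℚ ≤ f m) → ∀ N → sumTo N (λ m → sumTo (suc m) f) ≤ ι N * sumTo N f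
nested-sum≤ f f≥0 zero    = nonNegative⁻¹ (ι 0 * 0ℚ)
nested-sum≤ f f≥0 (suc N) = begin
  sumTo N (λ m → sumTo (suc m) f) + S  ≤⟨ +-monoˡ-≤ S (≤-trans (nested-sum≤ f f≥0 N) (*-monoˡ-≤-0≤ (nonNegative⁻¹ (ι N)) (≤-+-0≤ {sumTo N f} (f≥0 N)))) ⟩
  ι N * S + S                          ≡⟨ solve 2 (λ n s → n :* s :+ s := (con 1ℚ :+ n) :* s) refl (ι N) S ⟩
  (1ℚ + ι N) * S                       ≡⟨ cong (_* S) (sym (ι-suc N)) ⟩
  ι (suc N) * S                        ∎
  where
  open ≤-Reasoning
  S : ℚ
  S = sumTo (suc N) f

-- The boundary terms decrease with the order: the extra factor N coming from nested-sum≤ is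
-- absorbed by the extra denominator N+r+3.
boundary-anti : ∀ r N → boundary (suc r) N ≤ boundary r N
boundary-anti r N = begin
  A * (R₀ * c)          ≤⟨ *-monoʳ-≤-0≤ (nonNeg-* (R≥0 (suc N) (suc r)) (inv≥0 (suc N ℕ.+ suc r))) (nested-sum≤ (hyp r) (hyp≥0 r) N) ⟩
  (ι N * X) * (R₀ * c)  ≡⟨ solve 4 (λ n X R₀ c → (n :* X) :* (R₀ :* c) := (X :* R₀) :* (n :* c)) refl (ι N) X R₀ c ⟩
  (X * R₀) * (ι N * c)  ≤⟨ *-monoˡ-≤-0≤ (boundary≥0 r N) (ι*inv≤1 N≤N+r+3) ⟩
  (X * R₀) * 1ℚ         ≡⟨ *-identityʳ (X * R₀) ⟩
  X * R₀                ∎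
  where
  open ≤-Reasoning
  A X R₀ c : ℚ
  A = sumTo N (hyp (suc r))
  X = sumTo N (hyp r)
  R₀ = R (suc N) (suc r)
  c = inv (suc N ℕ.+ suc r)
  N≤N+r+3 : N ℕ.≤ suc (suc N ℕ.+ suc r)
  N≤N+r+3 = ℕP.≤-trans (ℕP.m≤m+n N (suc r)) (ℕP.≤-trans (ℕP.n≤1+n _) (ℕP.n≤1+n _))

boundary≤boundary-zero : ∀ r N → boundary r N ≤ boundary 0 N
boundary≤boundary-zero zero    N = ≤-refl
boundary≤boundary-zero (suc r) N = ≤-trans (boundary-anti r N) (boundary≤boundary-zero r N)

remainder≥0 : ∀ r N → 0ℚ ≤ remainder r N
remainder≥0 zero    N = subst (0ℚ ≤_) (sym (remainder-zero N)) (inv≥0 N)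
remainder≥0 (suc r) N = *-cancelˡ-≤-pos (ι (suc r))
  (subst₂ _≤_ (sym (*-zeroʳ (ι (suc r)))) (sym (remainder-suc r N))
          (+-mono-≤ (remainder≥0 r N) (boundary≥0 r N)))

-- Unfolding remainder-suc r times:  remainder r N ≤ 1/(N+1) + r · boundary 0 N.
remainder≤ : ∀ r N → remainder r N ≤ inv N + ι r * boundary 0 N
remainder≤ zero    N = begin
  remainder 0 N        ≡⟨ remainder-zero N ⟩
  inv N                ≡⟨ sym (+-identityʳ (inv N)) ⟩
  inv N + 0ℚ           ≡⟨ cong (inv N +_) (sym (*-zeroˡ (boundary 0 N))) ⟩
  inv N + 0ℚ * boundary 0 N ∎
  where open ≤-Reasoning
remainder≤ (suc r) N = begin
  e                                ≡⟨ sym (*-identityˡ e) ⟩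
  1ℚ * e                           ≤⟨ *-monoʳ-≤-0≤ (remainder≥0 (suc r) N) (ι-mono {1} {suc r} (ℕ.s≤s ℕ.z≤n)) ⟩
  ι (suc r) * e                    ≡⟨ remainder-suc r N ⟩
  remainder r N + boundary r N     ≤⟨ +-mono-≤ (remainder≤ r N) (boundary≤boundary-zero r N) ⟩
  inv N + ι r * B₀ + B₀            ≡⟨ solve 3 (λ a b d → a :+ b :* d :+ d := a :+ (con 1ℚ :+ b) :* d) refl (inv N) (ι r) B₀ ⟩
  inv N + (1ℚ + ι r) * B₀          ≡⟨ cong (λ t → inv N + t * B₀) (sym (ι-suc r)) ⟩
  inv N + ι (suc r) * B₀           ∎
  where
  open ≤-Reasoning
  e B₀ : ℚ
  e = remainder (suc r) N
  B₀ = boundary 0 N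

harmonic : ℕ → ℚ
harmonic N = sumTo N (hyp 0)

harmonic≤ι : ∀ N → harmonic N ≤ ι N
harmonic≤ι zero    = ≤-refl
harmonic≤ι (suc N) = begin
  harmonic N + inv N  ≤⟨ +-mono-≤ (harmonic≤ι N) (inv-anti {0} {N} ℕ.z≤n) ⟩
  ι N + 1ℚ            ≡⟨ +-comm (ι N) 1ℚ ⟩
  1ℚ + ι N            ≡⟨ sym (ι-suc N) ⟩
  ι (suc N)           ∎
  where open ≤-Reasoning

-- Splitting the harmonic sum at m:  H_N ≤ m + N/(m+1), since the first m summands are at most 1
-- and every later one is at most 1/(m+1).
harmonic-split : ∀ m N → harmonic N ≤ ι m + ι N * inv m
harmonic-split m zero = +-mono-≤ (nonNegative⁻¹ (ι m)) (nonNeg-* (nonNegative⁻¹ (ι 0)) (inv≥0 m))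
harmonic-split m (suc N) with N ℕ.<? m
... | yes N<m = begin
  harmonic (suc N)         ≤⟨ harmonic≤ι (suc N) ⟩
  ι (suc N)                ≤⟨ ι-mono N<m ⟩
  ι m                      ≤⟨ ≤-+-0≤ (nonNeg-* (nonNegative⁻¹ (ι (suc N))) (inv≥0 m)) ⟩
  ι m + ι (suc N) * inv m  ∎
  where open ≤-Reasoning
... | no N≮m = begin
  harmonic N + inv N           ≤⟨ +-mono-≤ (harmonic-split m N) (inv-anti (ℕP.≮⇒≥ N≮m)) ⟩
  ι m + ι N * inv m + inv m    ≡⟨ solve 3 (λ a n i → a :+ n :* i :+ i := a :+ (con 1ℚ :+ n) :* i) refl (ι m) (ι N) (inv m) ⟩
  ι m + (1ℚ + ι N) * inv m     ≡⟨ cong (λ t → ι m + t * inv m) (sym (ι-suc N)) ⟩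
  ι m + ι (suc N) * inv m      ∎
  where open ≤-Reasoning

boundary-zero≤ : ∀ m N → boundary 0 N ≤ ι m * inv N + inv m
boundary-zero≤ m N = begin
  harmonic N * R (suc N) 1         ≡⟨ cong (harmonic N *_) (R-one (suc N)) ⟩
  harmonic N * ρ                   ≤⟨ *-monoʳ-≤-0≤ (inv≥0 (suc N)) (harmonic-split m N) ⟩
  (ι m + ι N * inv m) * ρ          ≡⟨ solve 4 (λ a n i ρ → (a :+ n :* i) :* ρ := a :* ρ :+ (n :* ρ) :* i) refl (ι m) (ι N) (inv m) ρ ⟩
  ι m * ρ + (ι N * ρ) * inv m      ≤⟨ +-mono-≤ (*-monoˡ-≤-0≤ (nonNegative⁻¹ (ι m)) (inv-anti (ℕP.n≤1+n N)))
                                               (*-monoʳ-≤-0≤ (inv≥0 m) (ι*inv≤1 (ℕP.≤-trans (ℕP.n≤1+n N) (ℕP.n≤1+n (suc N))))) ⟩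
  ι m * inv N + 1ℚ * inv m         ≡⟨ cong (ι m * inv N +_) (*-identityˡ (inv m)) ⟩
  ι m * inv N + inv m              ∎
  where
  open ≤-Reasoning
  ρ : ℚ
  ρ = inv (suc N)

remainder-bound : ∀ r m N → remainder r N ≤ ι (suc (r ℕ.* m)) * inv N + ι r * inv m
remainder-bound r m N = begin
  remainder r N                                 ≤⟨ remainder≤ r N ⟩
  inv N + ι r * boundary 0 N                    ≤⟨ +-monoʳ-≤ (inv N) (*-monoˡ-≤-0≤ (nonNegative⁻¹ (ι r)) (boundary-zero≤ m N)) ⟩
  inv N + ι r * (ι m * inv N + inv m)           ≡⟨ solve 4 (λ i a b j → i :+ a :* (b :* i :+ j) := (con 1ℚ :+ a :* b) :* i :+ a :* j) refl (inv N) (ι r) (ι m) (inv m) ⟩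
  (1ℚ + ι r * ι m) * inv N + ι r * inv m        ≡⟨ cong (λ t → (1ℚ + t) * inv N + ι r * inv m) (sym (ι-* r m)) ⟩
  (1ℚ + ι (r ℕ.* m)) * inv N + ι r * inv m      ≡⟨ cong (λ t → t * inv N + ι r * inv m) (sym (ι-suc (r ℕ.* m))) ⟩
  ι (suc (r ℕ.* m)) * inv N + ι r * inv m       ∎
  where open ≤-Reasoning

inv≤pos : ∀ δ → 0ℚ < δ → ∃ λ d → inv d ≤ δ
inv≤pos (mkℚ +[1+ a ] d c) _ = d , subst (_≤ mkℚ +[1+ a ] d c) (sym (inv-nf d))
  (*≤* (subst₂ ℤ._≤_ (sym (ℤP.*-identityˡ _)) (ℤP.pos-* (suc a) (suc d)) (ℤ.+≤+ (ℕP.m≤n*m (suc d) (suc a)))))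
inv≤pos (mkℚ (ℤ.+ 0) d c) (*<* (ℤ.+<+ ()))
inv≤pos (mkℚ -[1+ a ] d c) (*<* ())

-- K/(n+1) tends to 0: if 1/(d+1) ≤ δ then K/(n+1) < δ for all n ≥ K(d+1), because
-- K/(K(d+1)+1) < 1/(d+1).
eventually-small : ∀ K δ → 0ℚ < δ → ∃ λ n → ∀ n' → n ℕ.≤ n' → ι K * inv n' < δ
eventually-small K δ δ>0 with inv≤pos δ δ>0
... | d , inv-d≤δ = n , λ n' n≤n' → ≤-<-trans (*-monoˡ-≤-0≤ (nonNegative⁻¹ (ι K)) (inv-anti n≤n')) (<-≤-trans K/n+1<1/d+1 inv-d≤δ)
  where
  n : ℕ
  n = K ℕ.* suc d
  -- clear both denominators by multiplying with (n+1)(d+1)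
  c : ℚ
  c = ι (suc n) * ι (suc d)
  c≥0 : 0ℚ ≤ c
  c≥0 = nonNeg-* (nonNegative⁻¹ (ι (suc n))) (nonNegative⁻¹ (ι (suc d)))
  lhs : ι K * inv n * c ≡ ι n
  lhs = begin
    ι K * inv n * (ι (suc n) * ι (suc d))  ≡⟨ solve 4 (λ k i s t → k :* i :* (s :* t) := k :* t :* (i :* s)) refl (ι K) (inv n) (ι (suc n)) (ι (suc d)) ⟩
    ι K * ι (suc d) * (inv n * ι (suc n))  ≡⟨ cong₂ _*_ (sym (ι-* K (suc d))) (inv-ι n) ⟩
    ι n * 1ℚ                               ≡⟨ *-identityʳ (ι n) ⟩
    ι n                                    ∎
    where open ≡-Reasoning
  rhs : inv d * c ≡ ι (suc n)
  rhs = begin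
    inv d * (ι (suc n) * ι (suc d))  ≡⟨ solve 3 (λ i s t → i :* (s :* t) := s :* (i :* t)) refl (inv d) (ι (suc n)) (ι (suc d)) ⟩
    ι (suc n) * (inv d * ι (suc d))  ≡⟨ cong (ι (suc n) *_) (inv-ι d) ⟩
    ι (suc n) * 1ℚ                   ≡⟨ *-identityʳ (ι (suc n)) ⟩
    ι (suc n)                        ∎
    where open ≡-Reasoning
  K/n+1<1/d+1 : ι K * inv n < inv d
  K/n+1<1/d+1 = *-cancelʳ-<-nonNeg c {{nonNegative c≥0}} (subst₂ _<_ (sym lhs) (sym rhs) (ι<ι-suc n))

distance≡remainder : ∀ r N → ∣ partialSum r N - invFact r ∣ ≡ remainder r N
distance≡remainder r N = begin
  ∣ partialSum r N - invFact r ∣  ≡⟨ cong ∣_∣ (solve 2 (λ s f → s :- f := :- (f :- s)) refl (partialSum r N) (invFact r)) ⟩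
  ∣ - remainder r N ∣             ≡⟨ ∣-p∣≡∣p∣ (remainder r N) ⟩
  ∣ remainder r N ∣               ≡⟨ 0≤p⇒∣p∣≡p (remainder≥0 r N) ⟩
  remainder r N                   ∎
  where open ≡-Reasoning

½ : ℚ
½ = ℤ.+ 1 / 2

-- Given ε > 0, pick m with r/(m+1) < ε/2, then N with (1 + r m)/(M+1) < ε/2 for all M ≥ N;
-- remainder-bound then bounds the distance at every M ≥ N by ε.
proposition5 : ∀ (r : ℕ) → ConvergesTo (partialSum r) (invFact r)
proposition5 r ε ε>0 = N , λ M M≥N → begin-strict
  ∣ partialSum r M - invFact r ∣             ≡⟨ distance≡remainder r M ⟩
  remainder r M                              ≤⟨ remainder-bound r m M ⟩
  ι (suc (r ℕ.* m)) * inv M + ι r * inv m    <⟨ +-mono-< (proj₂ N-small M M≥N) (proj₂ m-small m ℕP.≤-refl) ⟩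
  ε * ½ + ε * ½                              ≡⟨ sym (*-distribˡ-+ ε ½ ½) ⟩
  ε * 1ℚ                                     ≡⟨ *-identityʳ ε ⟩
  ε                                          ∎
  where
  open ≤-Reasoning
  ε/2>0 : 0ℚ < ε * ½
  ε/2>0 = positive⁻¹ (ε * ½) {{pos*pos⇒pos ε {{positive ε>0}} ½}}
  m-small : ∃ λ m → ∀ m' → m ℕ.≤ m' → ι r * inv m' < ε * ½
  m-small = eventually-small r (ε * ½) ε/2>0
  m : ℕ
  m = proj₁ m-small
  N-small : ∃ λ N → ∀ M → N ℕ.≤ M → ι (suc (r ℕ.* m)) * inv M < ε * ½
  N-small = eventually-small (suc (r ℕ.* m)) (ε * ½) ε/2>0
  N : ℕ
  N = proj₁ N-small
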